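{- Let $G$ be a connected graph with $n$ vertices and $m$ edges. Then $tmc(G)=m+n-3$ if and only if $G$ is either $K_n-K_3$ or $K_n-P_3$.
   Context: All graphs are simple, finite and undirected. A graph is total-colored if all its edges and all its vertices are assigned colors. A path in a total-colored graph is a total monochromatic path if all its edges and all its internal vertices have the same color. A total-coloring is a TMC-coloring if any two vertices are connected by a total monochromatic path. For a connected graph $G$, $tmc(G)$ is the maximum number of colors used in a TMC-coloring of $G$. For a graph $H$, $K_n-H$ denotes the graph obtained from $K_n$ by deleting the edges of a copy of $H$ in $K_n$. $P_3$ is the path on $3$ vertices (two edges), $K_3$ the triangle. -}

module Defs where

open import Data.Nat using (ℕ; _+_; _≤_; _<ᵇ_)
open import Data.Bool using (Bool; true; false; _∧_; if_then_else_)
open import Data.Fin using (Fin; toℕ)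
open import Data.List using (List; []; _∷_; _++_; map; allFin)
open import Data.Nat.ListAction using (sum)
open import Data.List.Relation.Unary.All using (All)
open import Data.List.Relation.Unary.Linked using (Linked)
open import Data.List.Relation.Unary.Unique.Propositional using (Unique)
open import Data.Product using (Σ; _×_; ∃; ∃₂)
open import Data.Sum using (_⊎_)
open import Relation.Binary.PropositionalEquality using (_≡_; _≢_)
open import Function.Bundles using (_⇔_)

record Graph (n : ℕ) : Set where
  field
    Adj    : Fin n → Fin n → Bool
    sym    : ∀ i j → Adj i j ≡ Adj j i
    irrefl : ∀ i → Adj i i ≡ false
open Graph public

edgeCount : {n : ℕ} → Graph n → ℕ
edgeCount {n} G =
  sum (map (λ i → sum (map (λ j → if (toℕ i <ᵇ toℕ j) ∧ Adj G i j then 1 else 0)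
                            (allFin n)))
           (allFin n))

IsPath : {n : ℕ} → Graph n → Fin n → List (Fin n) → Fin n → Set
IsPath G u xs v =
  Unique (u ∷ xs ++ v ∷ []) × Linked (λ a b → Adj G a b ≡ true) (u ∷ xs ++ v ∷ [])

Connected : {n : ℕ} → Graph n → Set
Connected {n} G = ∀ (u v : Fin n) → u ≢ v → ∃ λ xs → IsPath G u xs v

-- A total-coloring of G with colours Fin k using all k colours.
-- Edge {i,j} gets colour ce i j (= ce j i); values of ce on non-edges are irrelevant.
record TotalColoring {n : ℕ} (G : Graph n) (k : ℕ) : Set where
  field
    cv     : Fin n → Fin k
    ce     : Fin n → Fin n → Fin k
    ce-sym : ∀ i j → ce i j ≡ ce j i
    onto   : ∀ (c : Fin k) →
             (∃ λ v → cv v ≡ c) ⊎ (∃₂ λ i j → Adj G i j ≡ true × ce i j ≡ c)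
open TotalColoring public

IsTMPath : {n k : ℕ} {G : Graph n} → TotalColoring G k → Fin k →
           Fin n → List (Fin n) → Fin n → Set
IsTMPath {G = G} col c u xs v =
  Unique (u ∷ xs ++ v ∷ []) ×
  Linked (λ a b → Adj G a b ≡ true × ce col a b ≡ c) (u ∷ xs ++ v ∷ []) ×
  All (λ x → cv col x ≡ c) xs

IsTMC : {n k : ℕ} {G : Graph n} → TotalColoring G k → Set
IsTMC {n} {k} col = ∀ (u v : Fin n) → u ≢ v → ∃₂ λ (c : Fin k) xs → IsTMPath col c u xs v

HasTMC : {n : ℕ} → Graph n → ℕ → Set
HasTMC G k = Σ (TotalColoring G k) IsTMC

IsTmc : {n : ℕ} → Graph n → ℕ → Set
IsTmc G t = HasTMC G t × (∀ k → HasTMC G k → k ≤ t)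

SamePair : {n : ℕ} → Fin n → Fin n → Fin n → Fin n → Set
SamePair x y a b = (x ≡ a × y ≡ b) ⊎ (y ≡ a × x ≡ b)

IsKnMinusK3 : {n : ℕ} → Graph n → Set
IsKnMinusK3 {n} G = Σ (Fin n) λ a → Σ (Fin n) λ b → Σ (Fin n) λ c →
  a ≢ b × b ≢ c × a ≢ c ×
  (∀ x y → x ≢ y →
     (Adj G x y ≡ false ⇔ (SamePair x y a b ⊎ SamePair x y b c ⊎ SamePair x y a c)))

IsKnMinusP3 : {n : ℕ} → Graph n → Set
IsKnMinusP3 {n} G = Σ (Fin n) λ a → Σ (Fin n) λ b → Σ (Fin n) λ c →
  a ≢ b × b ≢ c × a ≢ c ×
  (∀ x y → x ≢ y →
     (Adj G x y ≡ false ⇔ (SamePair x y a b ⊎ SamePair x y b c)))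

module Submission where

open import Defs hiding (sym)
open import Data.Nat using (ℕ; zero; suc; _+_; _≤_; _<_; _<ᵇ_; z≤n; s≤s)
import Data.Nat.Properties as ℕ
open import Data.Bool using (Bool; true; false; _∧_; if_then_else_; T?)
import Data.Bool.Properties as Bool
open import Data.Fin using (Fin; toℕ) renaming (zero to fzero; suc to fsuc)
open import Data.Fin.Properties using (_≟_; any?; toℕ-injective)
open import Data.List using (List; []; _∷_; _++_; map; allFin; filter; length; lookup; cartesianProductWith)
open import Data.Nat.ListAction using (sum)
open import Data.List.Properties using (length-++; length-map; length-tabulate; filter-++)
open import Data.List.Relation.Unary.Any using (here; there; index)
open import Data.List.Relation.Unary.All as All using (All; []; _∷_)
open import Data.List.Relation.Unary.All.Properties as AllP using (All¬⇒¬Any; ¬Any⇒All¬)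
open import Data.List.Relation.Unary.AllPairs using ([]; _∷_)
open import Data.List.Relation.Unary.Linked using (Linked; []; [-]; _∷_)
open import Data.List.Membership.Propositional using (_∈_; _∉_)
open import Data.List.Membership.Propositional.Properties
open import Data.List.Relation.Binary.Subset.Propositional using (_⊆_)
open import Data.List.Relation.Unary.Unique.Propositional using (Unique)
import Data.List.Relation.Unary.Unique.Propositional.Properties as Unique
import Data.List.Membership.DecPropositional as DecMembership
open import Data.Product using (Σ; _×_; _,_; proj₁; proj₂; ∃; ∃₂)
open import Data.Sum using (_⊎_; inj₁; inj₂; [_,_])
open import Data.Empty using (⊥; ⊥-elim)
open import Function using (_∘_)
open import Function.Bundles using (_⇔_; mk⇔; Equivalence)
open import Relation.Nullary using (¬_; Dec; yes; no; ¬?)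
open import Relation.Nullary.Decidable using (_×-dec_; _⊎-dec_; decidable-stable)
open import Relation.Unary using (Decidable)
open import Relation.Binary.Definitions using (DecidableEquality; tri<; tri≈; tri>)
open import Relation.Binary.PropositionalEquality
  using (_≡_; _≢_; refl; sym; trans; cong; cong₂; subst; subst₂; ≢-sym; module ≡-Reasoning)

-- Let N = m + n be the number of elements (vertices and edges) of G.  If, in a total
-- colouring with k colours, each of r elements shares its colour with some element outside
-- them, then k + r ≤ N (colour-count); so a colour class of s + 1 elements forces k + s ≤ N.
-- In a TMC-colouring a non-edge uv is joined by a total monochromatic path; two internal
-- vertices would give a colour class of five elements, so usually the path is u – x – v and
-- x, ux, vx form a monochromatic star centred at x (nonadjacent-centre).  Comparing the stars
-- of two different non-edges shows that, unless k + 4 ≤ N, they share an endpoint and form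
-- one monochromatic star with three leaves (nonedges-star); this forces k + 3 ≤ N, and every
-- further non-edge must be a pair of its leaves.  Conversely, giving a list M of elements one
-- colour and every other element its own colour is a TMC-colouring with N + 1 − |M| colours
-- whenever every non-edge has a middle vertex x with ux, x, xv in M (Collapse).
-- Forward direction (Tight): if tmc(G) = N − 3, collapsing one vertex or one path u – x – v
-- shows that G has two non-edges; the star they form confines all non-edges to its three
-- leaves, giving K_n − P_3 or K_n − K_3.  Backward direction (Backward): the star bound gives
-- tmc(G) ≤ N − 3, and collapsing a neighbour y of b with its edges to a, b, c reaches it.

∈-remove : ∀ {A : Set} {x z : A} (as bs : List A) → z ∈ as ++ x ∷ bs → z ≢ x → z ∈ as ++ bs
∈-remove []       bs (here z≡x) z≢x = ⊥-elim (z≢x z≡x)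
∈-remove []       bs (there z∈) z≢x = z∈
∈-remove (a ∷ as) bs (here z≡a) z≢x = here z≡a
∈-remove (a ∷ as) bs (there z∈) z≢x = there (∈-remove as bs z∈ z≢x)

unique-⊆-length : ∀ {A : Set} {xs ys : List A} → Unique xs → xs ⊆ ys → length xs ≤ length ys
unique-⊆-length {xs = []}     _              _  = z≤n
unique-⊆-length {xs = x ∷ xs} (x∉xs ∷ uniq) xs⊆ys with ∈-∃++ (xs⊆ys (here refl))
... | as , bs , refl = subst (suc (length xs) ≤_) (sym removed-length)
        (s≤s (unique-⊆-length uniq λ z∈ → ∈-remove as bs (xs⊆ys (there z∈)) (≢-sym (All.lookup x∉xs z∈))))
  where
  removed-length : length (as ++ x ∷ bs) ≡ suc (length (as ++ bs))
  removed-length = trans (length-++ as) (trans (ℕ.+-suc (length as) _) (cong suc (sym (length-++ as))))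

length-filter-split : ∀ {A : Set} {P : A → Set} (P? : Decidable P) (xs : List A) →
                      length (filter P? xs) + length (filter (¬? ∘ P?) xs) ≡ length xs
length-filter-split P? [] = refl
length-filter-split P? (x ∷ xs) with P? x
... | yes _ = cong suc (length-filter-split P? xs)
... | no  _ = trans (ℕ.+-suc _ _) (cong suc (length-filter-split P? xs))

index-lookup-unique : ∀ {A : Set} {xs : List A} → Unique xs → ∀ i → (p : lookup xs i ∈ xs) → index p ≡ i
index-lookup-unique {xs = _ ∷ _} _             fzero    (here _)  = refl
index-lookup-unique {xs = _ ∷ _} (x∉xs ∷ _)    fzero    (there p) = ⊥-elim (All.lookup x∉xs p refl)
index-lookup-unique {xs = _ ∷ xs} (x∉xs ∷ _)   (fsuc i) (here eq) =
  ⊥-elim (All.lookup x∉xs (subst (_∈ xs) eq (∈-lookup i)) refl)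
index-lookup-unique {xs = _ ∷ _} (_ ∷ uniq)    (fsuc i) (there p) = cong fsuc (index-lookup-unique uniq i p)

-- The objects coloured by a total colouring of a graph on Fin n: vertices and
-- edges; an edge is represented by its endpoints with the smaller one first.
data Element (n : ℕ) : Set where
  V : Fin n → Element n
  E : Fin n → Fin n → Element n

V-injective : ∀ {n} {x y : Fin n} → V x ≡ V y → x ≡ y
V-injective refl = refl

E-injective : ∀ {n} {a b c d : Fin n} → E a b ≡ E c d → a ≡ c × b ≡ d
E-injective refl = refl , refl

_≟ᴱ_ : ∀ {n} → DecidableEquality (Element n)
V x   ≟ᴱ V y   with x ≟ y
... | yes refl = yes refl
... | no  x≢y  = no (x≢y ∘ V-injective)
V _   ≟ᴱ E _ _ = no λ ()
E _ _ ≟ᴱ V _   = no λ ()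
E a b ≟ᴱ E c d with a ≟ c | b ≟ d
... | yes refl | yes refl = yes refl
... | no  a≢c  | _        = no (a≢c ∘ proj₁ ∘ E-injective)
... | yes _    | no  b≢d  = no (b≢d ∘ proj₂ ∘ E-injective)

edge : ∀ {n} → Fin n → Fin n → Element n
edge u v = if toℕ u <ᵇ toℕ v then E u v else E v u

module _ {n : ℕ} where

  edge-< : ∀ {u v : Fin n} → toℕ u < toℕ v → edge u v ≡ E u v
  edge-< {u} {v} u<v rewrite Equivalence.to Bool.T-≡ (ℕ.<⇒<ᵇ u<v) = refl

  edge-≮ : ∀ {u v : Fin n} → toℕ v < toℕ u → edge u v ≡ E v u
  edge-≮ {u} {v} v<u with toℕ u <ᵇ toℕ v in u<ᵇv
  ... | true  = ⊥-elim (ℕ.<-asym v<u (ℕ.<ᵇ⇒< _ _ (Equivalence.from Bool.T-≡ u<ᵇv)))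
  ... | false = refl

  edge-sym : ∀ (u v : Fin n) → edge u v ≡ edge v u
  edge-sym u v with ℕ.<-cmp (toℕ u) (toℕ v)
  ... | tri< u<v _ _ = trans (edge-< u<v) (sym (edge-≮ u<v))
  ... | tri> _ _ v<u = trans (edge-≮ v<u) (sym (edge-< v<u))
  ... | tri≈ _ u≡v _ rewrite toℕ-injective u≡v = refl

  edge-cases : ∀ (u v : Fin n) → edge u v ≡ E u v ⊎ edge u v ≡ E v u
  edge-cases u v with toℕ u <ᵇ toℕ v
  ... | true  = inj₁ refl
  ... | false = inj₂ refl

  edge-injective : ∀ {a b c d : Fin n} → edge a b ≡ edge c d → (a ≡ c × b ≡ d) ⊎ (a ≡ d × b ≡ c)
  edge-injective {a} {b} {c} {d} eq with edge-cases a b | edge-cases c d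
  ... | inj₁ p | inj₁ q = inj₁ (E-injective (trans (sym p) (trans eq q)))
  ... | inj₂ p | inj₂ q = let b≡d , a≡c = E-injective (trans (sym p) (trans eq q)) in inj₁ (a≡c , b≡d)
  ... | inj₁ p | inj₂ q = let a≡d , b≡c = E-injective (trans (sym p) (trans eq q)) in inj₂ (a≡d , b≡c)
  ... | inj₂ p | inj₁ q = let b≡c , a≡d = E-injective (trans (sym p) (trans eq q)) in inj₂ (a≡d , b≡c)

  V≢edge : ∀ {x u v : Fin n} → V x ≢ edge u v
  V≢edge {x} {u} {v} eq with edge-cases u v
  ... | inj₁ p with () ← trans eq p
  ... | inj₂ p with () ← trans eq p

  edge-≢-shared : ∀ {p q x : Fin n} → p ≢ q → edge p x ≢ edge q x
  edge-≢-shared p≢q eq with edge-injective eq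
  ... | inj₁ (p≡q , _)   = p≢q p≡q
  ... | inj₂ (p≡x , x≡q) = p≢q (trans p≡x x≡q)

module _ {n : ℕ} (G : Graph n) where

  adj-sym : ∀ {u v b} → Adj G u v ≡ b → Adj G v u ≡ b
  adj-sym {u} {v} uv = trans (Graph.sym G v u) uv

  adjacent-≢ : ∀ {u v} → Adj G u v ≡ true → u ≢ v
  adjacent-≢ {u} uv refl with () ← trans (sym uv) (irrefl G u)

module Elements {n : ℕ} (G : Graph n) where

  isEdge : Element n → Bool
  isEdge (V _)   = false
  isEdge (E i j) = (toℕ i <ᵇ toℕ j) ∧ Adj G i j

  pairs : List (Element n)
  pairs = cartesianProductWith E (allFin n) (allFin n)

  edgeList : List (Element n)
  edgeList = filter (T? ∘ isEdge) pairs

  elements : List (Element n)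
  elements = map V (allFin n) ++ edgeList

  N : ℕ
  N = length elements

  edgeList-length : length edgeList ≡ edgeCount G
  edgeList-length = rows (allFin n)
    where
    open ≡-Reasoning
    indicator : Fin n → Fin n → ℕ
    indicator i j = if (toℕ i <ᵇ toℕ j) ∧ Adj G i j then 1 else 0
    row : ∀ i ys → length (filter (T? ∘ isEdge) (map (E i) ys)) ≡ sum (map (indicator i) ys)
    row i []       = refl
    row i (j ∷ ys) with (toℕ i <ᵇ toℕ j) ∧ Adj G i j
    ... | true  = cong suc (row i ys)
    ... | false = row i ys
    rows : ∀ xs → length (filter (T? ∘ isEdge) (cartesianProductWith E xs (allFin n))) ≡
                  sum (map (λ i → sum (map (indicator i) (allFin n))) xs)
    rows []       = refl
    rows (i ∷ xs) = begin
      length (filter (T? ∘ isEdge) (map (E i) (allFin n) ++ cartesianProductWith E xs (allFin n)))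
        ≡⟨ cong length (filter-++ (T? ∘ isEdge) (map (E i) (allFin n)) _) ⟩
      length (filter (T? ∘ isEdge) (map (E i) (allFin n)) ++
              filter (T? ∘ isEdge) (cartesianProductWith E xs (allFin n)))
        ≡⟨ length-++ (filter (T? ∘ isEdge) (map (E i) (allFin n))) ⟩
      length (filter (T? ∘ isEdge) (map (E i) (allFin n))) +
      length (filter (T? ∘ isEdge) (cartesianProductWith E xs (allFin n)))
        ≡⟨ cong₂ _+_ (row i (allFin n)) (rows xs) ⟩
      sum (map (indicator i) (allFin n)) + sum (map (λ i → sum (map (indicator i) (allFin n))) xs)
        ∎

  N≡m+n : N ≡ edgeCount G + n
  N≡m+n = begin
    length (map V (allFin n) ++ edgeList)
      ≡⟨ length-++ (map V (allFin n)) ⟩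
    length (map V (allFin n)) + length edgeList
      ≡⟨ cong₂ _+_ (trans (length-map V (allFin n)) (length-tabulate _)) edgeList-length ⟩
    n + edgeCount G
      ≡⟨ ℕ.+-comm n _ ⟩
    edgeCount G + n
      ∎
    where open ≡-Reasoning

  elements-unique : Unique elements
  elements-unique =
    Unique.++⁺ (Unique.map⁺ V-injective (Unique.allFin⁺ n))
               (Unique.filter⁺ (T? ∘ isEdge)
                 (Unique.cartesianProductWith⁺ E E-injective (Unique.allFin⁺ n) (Unique.allFin⁺ n)))
               vertex-not-edge
    where
    vertex-not-edge : ∀ {e} → e ∈ map V (allFin n) × e ∈ edgeList → ⊥
    vertex-not-edge (e∈V , e∈E) with ∈-map⁻ V e∈V | ∈-filter⁻ (T? ∘ isEdge) {xs = pairs} e∈E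
    ... | _ , _ , refl | _ , ()

  V∈elements : ∀ x → V x ∈ elements
  V∈elements x = ∈-++⁺ˡ (∈-map⁺ V (∈-allFin x))

  E∈elements : ∀ {i j} → toℕ i < toℕ j → Adj G i j ≡ true → E i j ∈ elements
  E∈elements {i} {j} i<j ij = ∈-++⁺ʳ (map V (allFin n))
    (∈-filter⁺ (T? ∘ isEdge) (∈-cartesianProductWith⁺ E (∈-allFin i) (∈-allFin j))
      (Equivalence.from Bool.T-∧ (ℕ.<⇒<ᵇ i<j , Equivalence.from Bool.T-≡ ij)))

  edge∈elements : ∀ {u v} → Adj G u v ≡ true → edge u v ∈ elements
  edge∈elements {u} {v} uv with ℕ.<-cmp (toℕ u) (toℕ v)
  ... | tri< u<v _ _ = subst (_∈ elements) (sym (edge-< u<v)) (E∈elements u<v uv)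
  ... | tri> _ _ v<u = subst (_∈ elements) (sym (edge-≮ v<u)) (E∈elements v<u (adj-sym G uv))
  ... | tri≈ _ u≡v _ rewrite toℕ-injective u≡v with () ← trans (sym uv) (irrefl G v)

  element-cases : ∀ {e} → e ∈ elements → (∃ λ x → e ≡ V x) ⊎ (∃₂ λ u v → Adj G u v ≡ true × e ≡ edge u v)
  element-cases {e} e∈ with ∈-++⁻ (map V (allFin n)) e∈
  ... | inj₁ e∈V = let x , _ , e≡Vx = ∈-map⁻ V e∈V in inj₁ (x , e≡Vx)
  element-cases {V x}   _ | inj₂ _ = inj₁ (x , refl)
  element-cases {E i j} _ | inj₂ e∈E
    with i<ᵇj , ij ← Equivalence.to Bool.T-∧ (proj₂ (∈-filter⁻ (T? ∘ isEdge) {xs = pairs} e∈E))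
    = inj₂ (i , j , Equivalence.to Bool.T-≡ ij , sym (edge-< (ℕ.<ᵇ⇒< _ _ i<ᵇj)))

colour-count : ∀ {A : Set} → DecidableEquality A → ∀ {k} (colour : A → Fin k) (L R : List A) →
               Unique R → R ⊆ L → (∀ c → ∃ λ e → e ∈ L × e ∉ R × colour e ≡ c) →
               k + length R ≤ length L
colour-count {A} _≟_ {k} colour L R R-unique R⊆L colour-outside =
  subst (k + length R ≤_) lengths (ℕ.+-mono-≤ colours≤outside R≤inside)
  where
  open DecMembership _≟_ using (_∈?_)
  inside outside : List A
  inside  = filter (_∈? R) L
  outside = filter (¬? ∘ (_∈? R)) L
  lengths : length outside + length inside ≡ length L
  lengths = trans (ℕ.+-comm (length outside) _) (length-filter-split (_∈? R) L)
  colours≤outside : k ≤ length outside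
  colours≤outside = subst₂ _≤_ (length-tabulate _) (length-map colour outside)
    (unique-⊆-length (Unique.allFin⁺ k) λ {c} _ →
      let e , e∈L , e∉R , colour-e = colour-outside c
      in subst (_∈ map colour outside) colour-e (∈-map⁺ colour (∈-filter⁺ (¬? ∘ (_∈? R)) e∈L e∉R)))
  R≤inside : length R ≤ length inside
  R≤inside = unique-⊆-length R-unique λ r∈R → ∈-filter⁺ (_∈? R) (R⊆L r∈R) r∈R

PairOf : ∀ {n} → Fin n → Fin n → Fin n → Fin n → Fin n → Set
PairOf s t p q r = SamePair s t p q ⊎ SamePair s t q r ⊎ SamePair s t p r

pair-of-leaves : ∀ {n} {s t p q r : Fin n} → s ≢ t → s ∈ p ∷ q ∷ r ∷ [] → t ∈ p ∷ q ∷ r ∷ [] → PairOf s t p q r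
pair-of-leaves s≢t (here refl)                 (here refl)                 = ⊥-elim (s≢t refl)
pair-of-leaves s≢t (here refl)                 (there (here refl))         = inj₁ (inj₁ (refl , refl))
pair-of-leaves s≢t (here refl)                 (there (there (here refl))) = inj₂ (inj₂ (inj₁ (refl , refl)))
pair-of-leaves s≢t (there (here refl))         (here refl)                 = inj₁ (inj₂ (refl , refl))
pair-of-leaves s≢t (there (here refl))         (there (here refl))         = ⊥-elim (s≢t refl)
pair-of-leaves s≢t (there (here refl))         (there (there (here refl))) = inj₂ (inj₁ (inj₁ (refl , refl)))
pair-of-leaves s≢t (there (there (here refl))) (here refl)                 = inj₂ (inj₂ (inj₂ (refl , refl)))
pair-of-leaves s≢t (there (there (here refl))) (there (here refl))         = inj₂ (inj₁ (inj₂ (refl , refl)))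
pair-of-leaves s≢t (there (there (here refl))) (there (there (here refl))) = ⊥-elim (s≢t refl)

same-pair? : ∀ {n} (s t p q : Fin n) → Dec (SamePair s t p q)
same-pair? s t p q = ((s ≟ p) ×-dec (t ≟ q)) ⊎-dec ((t ≟ p) ×-dec (s ≟ q))

same-pair-nonadjacent : ∀ {n} (G : Graph n) {s t p q} → Adj G p q ≡ false → SamePair s t p q → Adj G s t ≡ false
same-pair-nonadjacent G pq (inj₁ (refl , refl)) = pq
same-pair-nonadjacent G pq (inj₂ (refl , refl)) = adj-sym G pq

module Counting {n k : ℕ} {G : Graph n} (col : TotalColoring G k) where
  open Elements G

  colourOf : Element n → Fin k
  colourOf (V x)   = cv col x
  colourOf (E i j) = ce col i j

  colourOf-edge : ∀ u v → colourOf (edge u v) ≡ ce col u v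
  colourOf-edge u v with toℕ u <ᵇ toℕ v
  ... | true  = refl
  ... | false = ce-sym col v u

  colour-used : ∀ c → ∃ λ e → e ∈ elements × colourOf e ≡ c
  colour-used c with onto col c
  ... | inj₁ (x , x-c)          = V x , V∈elements x , x-c
  ... | inj₂ (u , v , uv , uv-c) = edge u v , edge∈elements uv , trans (colourOf-edge u v) uv-c

  -- If each member of a duplicate-free R ⊆ elements shares its colour with an
  -- element outside R, then R can be discarded without losing a colour: k + |R| ≤ N.
  redundancy-bound : ∀ R → Unique R → All (_∈ elements) R →
                     (∀ {r} → r ∈ R → ∃ λ w → w ∈ elements × w ∉ R × colourOf w ≡ colourOf r) →
                     k + length R ≤ N
  redundancy-bound R R-unique R⊆ witness = colour-count _≟ᴱ_ colourOf elements R R-unique (All.lookup R⊆) outside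
    where
    open DecMembership (_≟ᴱ_ {n}) using (_∈?_)
    outside : ∀ c → ∃ λ e → e ∈ elements × e ∉ R × colourOf e ≡ c
    outside c with colour-used c
    ... | e , e∈ , e-c with e ∈? R
    ...   | no  e∉R = e , e∈ , e∉R , e-c
    ...   | yes e∈R = let w , w∈ , w∉R , w-e = witness e∈R in w , w∈ , w∉R , trans w-e e-c

  class-bound : ∀ {α e R} → Unique (e ∷ R) → All (_∈ elements) (e ∷ R) →
                All (λ r → colourOf r ≡ α) (e ∷ R) → k + length R ≤ N
  class-bound {e = e} {R} (e∉R ∷ R-unique) (e∈ ∷ R⊆) (e-α ∷ R-α) =
    redundancy-bound R R-unique R⊆ λ r∈R → e , e∈ , All¬⇒¬Any e∉R , trans e-α (sym (All.lookup R-α r∈R))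

  two-classes-bound : ∀ {α β e f R S} → α ≢ β →
                      Unique (e ∷ R) → All (_∈ elements) (e ∷ R) → All (λ r → colourOf r ≡ α) (e ∷ R) →
                      Unique (f ∷ S) → All (_∈ elements) (f ∷ S) → All (λ s → colourOf s ≡ β) (f ∷ S) →
                      k + (length R + length S) ≤ N
  two-classes-bound {α} {β} {e} {f} {R} {S} α≢β (e∉R ∷ R-unique) (e∈ ∷ R⊆) (e-α ∷ R-α)
                                               (f∉S ∷ S-unique) (f∈ ∷ S⊆) (f-β ∷ S-β) =
    subst (λ l → k + l ≤ N) (length-++ R)
      (redundancy-bound (R ++ S) (Unique.++⁺ R-unique S-unique R∩S-empty) (AllP.++⁺ R⊆ S⊆) witness)
    where
    clash : ∀ x → colourOf x ≡ α → colourOf x ≡ β → ⊥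
    clash _ x-α x-β = α≢β (trans (sym x-α) x-β)
    R∩S-empty : ∀ {x} → x ∈ R × x ∈ S → ⊥
    R∩S-empty {x} (x∈R , x∈S) = clash x (All.lookup R-α x∈R) (All.lookup S-β x∈S)
    e∉ : e ∉ R ++ S
    e∉ e∈RS with ∈-++⁻ R e∈RS
    ... | inj₁ e∈R = All¬⇒¬Any e∉R e∈R
    ... | inj₂ e∈S = clash e e-α (All.lookup S-β e∈S)
    f∉ : f ∉ R ++ S
    f∉ f∈RS with ∈-++⁻ R f∈RS
    ... | inj₁ f∈R = clash f (All.lookup R-α f∈R) f-β
    ... | inj₂ f∈S = All¬⇒¬Any f∉S f∈S
    witness : ∀ {r} → r ∈ R ++ S → ∃ λ w → w ∈ elements × w ∉ R ++ S × colourOf w ≡ colourOf r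
    witness r∈ with ∈-++⁻ R r∈
    ... | inj₁ r∈R = e , e∈ , e∉ , trans e-α (sym (All.lookup R-α r∈R))
    ... | inj₂ r∈S = f , f∈ , f∉ , trans f-β (sym (All.lookup S-β r∈S))

  Spoke : Fin n → Fin n → Set
  Spoke x p = Adj G p x ≡ true × colourOf (edge p x) ≡ cv col x

  star : Fin n → List (Fin n) → List (Element n)
  star x ps = V x ∷ map (λ p → edge p x) ps

  star-unique : ∀ {x ps} → Unique ps → Unique (star x ps)
  star-unique ps-unique =
    All.tabulate (λ e∈ → let _ , _ , e≡ = ∈-map⁻ _ e∈ in λ Vx≡e → V≢edge (trans Vx≡e e≡))
    ∷ Unique.map⁺ edge-injective-at ps-unique
    where
    edge-injective-at : ∀ {x p q} → edge p x ≡ edge q x → p ≡ q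
    edge-injective-at {p = p} {q} eq with p ≟ q
    ... | yes p≡q = p≡q
    ... | no  p≢q = ⊥-elim (edge-≢-shared p≢q eq)

  star-∈ : ∀ {x ps} → All (Spoke x) ps → All (_∈ elements) (star x ps)
  star-∈ {x} spokes = V∈elements x ∷ AllP.map⁺ (All.map (edge∈elements ∘ proj₁) spokes)

  star-colour : ∀ {x ps} → All (Spoke x) ps → All (λ e → colourOf e ≡ cv col x) (star x ps)
  star-colour spokes = refl ∷ AllP.map⁺ (All.map proj₂ spokes)

  star-bound : ∀ {x ps} → Unique ps → All (Spoke x) ps → k + length ps ≤ N
  star-bound {x} {ps} ps-unique spokes =
    subst (λ l → k + l ≤ N) (length-map _ ps)
      (class-bound (star-unique ps-unique) (star-∈ spokes) (star-colour spokes))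

  two-stars-bound : ∀ {x y ps qs} → cv col x ≢ cv col y →
                    Unique ps → All (Spoke x) ps → Unique qs → All (Spoke y) qs →
                    k + (length ps + length qs) ≤ N
  two-stars-bound {x} {y} {ps} {qs} x≢y ps-unique x-spokes qs-unique y-spokes =
    subst (λ l → k + l ≤ N) (cong₂ _+_ (length-map _ ps) (length-map _ qs))
      (two-classes-bound x≢y (star-unique ps-unique) (star-∈ x-spokes) (star-colour x-spokes)
                             (star-unique qs-unique) (star-∈ y-spokes) (star-colour y-spokes))

  star-member : ∀ {x ps e} → e ∈ star x ps → e ≡ V x ⊎ ∃ λ p → p ∈ ps × e ≡ edge p x
  star-member (here e≡Vx) = inj₁ e≡Vx
  star-member (there e∈)  = inj₂ (∈-map⁻ _ e∈)

  twin-stars-bound : ∀ {x y ps qs} → y ≢ x → cv col y ≡ cv col x →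
                     Unique ps → All (Spoke x) ps → Unique qs → All (_≢ x) qs → All (Spoke y) qs →
                     k + (length ps + suc (length qs)) ≤ N
  twin-stars-bound {x} {y} {ps} {qs} y≢x y~x ps-unique x-spokes qs-unique qs≢x y-spokes =
    subst (λ l → k + l ≤ N) lengths
      (class-bound (Unique.++⁺ (star-unique ps-unique) (star-unique qs-unique) disjoint)
                   (AllP.++⁺ (star-∈ x-spokes) (star-∈ y-spokes))
                   (AllP.++⁺ (star-colour x-spokes) (All.map (λ e-y → trans e-y y~x) (star-colour y-spokes))))
    where
    lengths : length (map (λ p → edge p x) ps ++ star y qs) ≡ length ps + suc (length qs)
    lengths = trans (length-++ (map (λ p → edge p x) ps))
                    (cong₂ _+_ (length-map _ ps) (cong suc (length-map _ qs)))
    disjoint : ∀ {e} → e ∈ star x ps × e ∈ star y qs → ⊥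
    disjoint (e∈x , e∈y) with star-member e∈x | star-member e∈y
    ... | inj₁ e≡Vx | inj₁ e≡Vy = y≢x (V-injective (trans (sym e≡Vy) e≡Vx))
    ... | inj₁ e≡Vx | inj₂ (_ , _ , e≡qy) = V≢edge (trans (sym e≡Vx) e≡qy)
    ... | inj₂ (_ , _ , e≡px) | inj₁ e≡Vy = V≢edge (trans (sym e≡Vy) e≡px)
    ... | inj₂ (_ , _ , e≡px) | inj₂ (_ , q∈ , e≡qy) with edge-injective (trans (sym e≡px) e≡qy)
    ...   | inj₁ (_ , x≡y) = y≢x (sym x≡y)
    ...   | inj₂ (_ , x≡q) = All.lookup qs≢x q∈ (sym x≡q)

  ColouredEdge : Fin k → Fin n → Fin n → Set
  ColouredEdge c a b = Adj G a b ≡ true × ce col a b ≡ c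

  coloured-edge-sym : ∀ {c a b} → ColouredEdge c a b → ColouredEdge c b a
  coloured-edge-sym {a = a} {b} (ab , ab-c) = adj-sym G ab , trans (ce-sym col b a) ab-c

  spoke : ∀ {c p x} → ColouredEdge c p x → cv col x ≡ c → Spoke x p
  spoke {p = p} {x} (px , px-c) x-c = px , trans (colourOf-edge p x) (trans px-c (sym x-c))

module TMCStructure {n k : ℕ} {G : Graph n} (col : TotalColoring G k) where
  open Elements G
  open Counting col
  open DecMembership (_≟_ {n}) using (_∈?_)

  Centre : Fin n → Fin n → Fin n → Set
  Centre u v x = Spoke x u × Spoke x v

  -- Two consecutive internal vertices of a monochromatic path give a colour class of
  -- five elements: both vertices and the three edges around them.
  long-path-bound : ∀ {c u x₁ x₂ w L} → Unique (u ∷ x₁ ∷ x₂ ∷ w ∷ L) →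
                    Linked (ColouredEdge c) (u ∷ x₁ ∷ x₂ ∷ w ∷ L) → cv col x₁ ≡ c → cv col x₂ ≡ c →
                    k + 4 ≤ N
  long-path-bound ((_ ∷ u≢x₂ ∷ _) ∷ (x₁≢x₂ ∷ x₁≢w ∷ _) ∷ _) (ux₁ ∷ x₁x₂ ∷ x₂w ∷ _) x₁-c x₂-c =
    twin-stars-bound (≢-sym x₁≢x₂) (trans x₂-c (sym x₁-c))
      ((u≢x₂ ∷ []) ∷ [] ∷ []) (spoke ux₁ x₁-c ∷ spoke (coloured-edge-sym x₁x₂) x₁-c ∷ [])
      ([] ∷ []) (≢-sym x₁≢w ∷ []) (spoke (coloured-edge-sym x₂w) x₂-c ∷ [])

  nonadjacent-centre : IsTMC col → ∀ u v → u ≢ v → Adj G u v ≡ false → (k + 4 ≤ N) ⊎ ∃ (Centre u v)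
  nonadjacent-centre tmc u v u≢v uv with tmc u v u≢v
  ... | _ , []               , _ , (uv′ ∷ _) , _ with () ← trans (sym (proj₁ uv′)) uv
  ... | _ , x ∷ []           , _ , (ux ∷ xv ∷ _) , (x-c ∷ _) = inj₂ (x , spoke ux x-c , spoke (coloured-edge-sym xv) x-c)
  ... | _ , x₁ ∷ x₂ ∷ []     , path , links , (x₁-c ∷ x₂-c ∷ _) = inj₁ (long-path-bound path links x₁-c x₂-c)
  ... | _ , x₁ ∷ x₂ ∷ _ ∷ _  , path , links , (x₁-c ∷ x₂-c ∷ _) = inj₁ (long-path-bound path links x₁-c x₂-c)

  Star3 : Fin n → Fin n → Fin n → Fin n → Set
  Star3 x p q r = Unique (p ∷ q ∷ r ∷ []) × All (Spoke x) (p ∷ q ∷ r ∷ [])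

  NonEdgeStar : Set
  NonEdgeStar = ∃ λ x → ∃ λ p → ∃ λ q → ∃ λ r → Star3 x p q r × Adj G p q ≡ false × Adj G q r ≡ false

  star3-bound : ∀ {x p q r} → Star3 x p q r → k + 3 ≤ N
  star3-bound (leaves-unique , spokes) = star-bound leaves-unique spokes

  -- Centres of two different non-edges {a,b} and {c,d} at the same vertex x: either the
  -- four leaves are distinct (k + 4 ≤ N) or the two non-edges share an endpoint and form a 3-star.
  shared-centre : ∀ {x a b c d} → a ≢ b → c ≢ d → ¬ SamePair c d a b →
                  Adj G a b ≡ false → Adj G c d ≡ false → Centre a b x → Centre c d x →
                  (k + 4 ≤ N) ⊎ NonEdgeStar
  shared-centre {x} {a} {b} {c} {d} a≢b c≢d ¬cd~ab ab cd (xa , xb) (xc , xd) with c ≟ a | c ≟ b | d ≟ a | d ≟ b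
  ... | yes refl | _ | _ | _ =
    inj₂ (x , b , c , d , (((≢-sym a≢b ∷ (λ b≡d → ¬cd~ab (inj₁ (refl , sym b≡d))) ∷ []) ∷ (c≢d ∷ []) ∷ [] ∷ []) ,
                            xb ∷ xa ∷ xd ∷ []) , adj-sym G ab , cd)
  ... | no _ | yes refl | _ | _ =
    inj₂ (x , a , c , d , (((a≢b ∷ (λ a≡d → ¬cd~ab (inj₂ (sym a≡d , refl))) ∷ []) ∷ (c≢d ∷ []) ∷ [] ∷ []) ,
                            xa ∷ xb ∷ xd ∷ []) , ab , cd)
  ... | no _ | no c≢b | yes refl | _ =
    inj₂ (x , b , d , c , (((≢-sym a≢b ∷ ≢-sym c≢b ∷ []) ∷ (≢-sym c≢d ∷ []) ∷ [] ∷ []) ,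
                            xb ∷ xa ∷ xc ∷ []) , adj-sym G ab , adj-sym G cd)
  ... | no c≢a | no _ | no _ | yes refl =
    inj₂ (x , a , d , c , (((a≢b ∷ ≢-sym c≢a ∷ []) ∷ (≢-sym c≢d ∷ []) ∷ [] ∷ []) ,
                            xa ∷ xb ∷ xc ∷ []) , ab , adj-sym G cd)
  ... | no c≢a | no c≢b | no d≢a | no d≢b =
    inj₁ (star-bound ((a≢b ∷ ≢-sym c≢a ∷ ≢-sym d≢a ∷ []) ∷ (≢-sym c≢b ∷ ≢-sym d≢b ∷ []) ∷ (c≢d ∷ []) ∷ [] ∷ [])
                     (xa ∷ xb ∷ xc ∷ xd ∷ []))

  two-centres : ∀ {x y a b c d} → a ≢ b → c ≢ d → ¬ SamePair c d a b →
                Adj G a b ≡ false → Adj G c d ≡ false → Centre a b x → Centre c d y →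
                (k + 4 ≤ N) ⊎ NonEdgeStar
  two-centres {x} {y} {a} {b} {c} {d} a≢b c≢d ¬cd~ab ab cd (xa , xb) (yc , yd)
    with cv col y ≟ cv col x | y ≟ x
  ... | no x≁y    | _        =
    inj₁ (two-stars-bound (≢-sym x≁y) ((a≢b ∷ []) ∷ [] ∷ []) (xa ∷ xb ∷ []) ((c≢d ∷ []) ∷ [] ∷ []) (yc ∷ yd ∷ []))
  ... | yes y~x   | yes refl = shared-centre a≢b c≢d ¬cd~ab ab cd (xa , xb) (yc , yd)
  ... | yes y~x   | no  y≢x with c ≟ x
  ...   | no  c≢x = inj₁ (twin-stars-bound y≢x y~x ((a≢b ∷ []) ∷ [] ∷ []) (xa ∷ xb ∷ []) ([] ∷ []) (c≢x ∷ []) (yc ∷ []))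
  ...   | yes c≡x = inj₁ (twin-stars-bound y≢x y~x ((a≢b ∷ []) ∷ [] ∷ []) (xa ∷ xb ∷ []) ([] ∷ [])
                                           ((λ d≡x → c≢d (trans c≡x (sym d≡x))) ∷ []) (yd ∷ []))

  leaf-or-bound : ∀ {x p q r s} → Star3 x p q r → Spoke x s → (k + 4 ≤ N) ⊎ s ∈ p ∷ q ∷ r ∷ []
  leaf-or-bound {p = p} {q} {r} {s} (leaves-unique , spokes) xs with s ∈? p ∷ q ∷ r ∷ []
  ... | yes s∈ = inj₂ s∈
  ... | no  s∉ = inj₁ (star-bound (¬Any⇒All¬ _ s∉ ∷ leaves-unique) (xs ∷ spokes))

  nonedge-in-star : ∀ {x p q r s t z} → Star3 x p q r → s ≢ t → Centre s t z →
                    (k + 4 ≤ N) ⊎ PairOf s t p q r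
  nonedge-in-star {x} {z = z} star3@(leaves-unique@((p≢q ∷ _) ∷ _) , xp ∷ xq ∷ xr ∷ []) s≢t (zs , zt)
    with cv col z ≟ cv col x | z ≟ x
  ... | no z≁x  | _        =
    inj₁ (two-stars-bound z≁x ((s≢t ∷ []) ∷ [] ∷ []) (zs ∷ zt ∷ []) ((p≢q ∷ []) ∷ [] ∷ []) (xp ∷ xq ∷ []))
  ... | yes z~x | no  z≢x = inj₁ (twin-stars-bound z≢x z~x leaves-unique (xp ∷ xq ∷ xr ∷ []) [] [] [])
  ... | yes _   | yes refl with leaf-or-bound star3 zs | leaf-or-bound star3 zt
  ...   | inj₁ bound | _          = inj₁ bound
  ...   | inj₂ _     | inj₁ bound = inj₁ bound
  ...   | inj₂ s∈    | inj₂ t∈    = inj₂ (pair-of-leaves s≢t s∈ t∈)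

  nonedges-star : IsTMC col → ∀ {a b c d} → a ≢ b → c ≢ d → ¬ SamePair c d a b →
                  Adj G a b ≡ false → Adj G c d ≡ false → (k + 4 ≤ N) ⊎ NonEdgeStar
  nonedges-star tmc {a} {b} {c} {d} a≢b c≢d cd≁ab ab cd
    with nonadjacent-centre tmc a b a≢b ab | nonadjacent-centre tmc c d c≢d cd
  ... | inj₁ bound   | _            = inj₁ bound
  ... | inj₂ _       | inj₁ bound   = inj₁ bound
  ... | inj₂ (_ , x) | inj₂ (_ , y) = two-centres a≢b c≢d cd≁ab ab cd x y

  two-nonedges-bound : IsTMC col → ∀ {a b c} → a ≢ b → b ≢ c → a ≢ c →
                       Adj G a b ≡ false → Adj G b c ≡ false → k + 3 ≤ N
  two-nonedges-bound tmc {a} {b} {c} a≢b b≢c a≢c ab bc with nonedges-star tmc a≢b b≢c bc≁ab ab bc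
    where
    bc≁ab : ¬ SamePair b c a b
    bc≁ab (inj₁ (b≡a , _)) = a≢b (sym b≡a)
    bc≁ab (inj₂ (c≡a , _)) = a≢c (sym c≡a)
  ... | inj₁ k+4≤N                       = ℕ.≤-trans (ℕ.+-monoʳ-≤ k (ℕ.n≤1+n 3)) k+4≤N
  ... | inj₂ (_ , _ , _ , _ , star3 , _) = star3-bound star3

module Collapse {n : ℕ} (G : Graph n) (M : List (Element n)) where
  open Elements G
  open DecMembership (_≟ᴱ_ {n}) using (_∈?_)

  rest : List (Element n)
  rest = filter (¬? ∘ (_∈? M)) elements

  colour : Element n → Fin (suc (length rest))
  colour e with e ∈? rest
  ... | yes e∈ = fsuc (index e∈)
  ... | no  _  = fzero

  colour-M : ∀ {e} → e ∈ M → colour e ≡ fzero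
  colour-M {e} e∈M with e ∈? rest
  ... | yes e∈ = ⊥-elim (proj₂ (∈-filter⁻ (¬? ∘ (_∈? M)) {xs = elements} e∈) e∈M)
  ... | no  _  = refl

  colour-rest : ∀ i → colour (lookup rest i) ≡ fsuc i
  colour-rest i with lookup rest i ∈? rest
  ... | yes e∈ = cong fsuc (index-lookup-unique (Unique.filter⁺ (¬? ∘ (_∈? M)) elements-unique) i e∈)
  ... | no  e∉ = ⊥-elim (e∉ (∈-lookup i))

  MiddlesIn : Set
  MiddlesIn = ∀ u v → u ≢ v → Adj G u v ≡ false →
              ∃ λ x → Adj G u x ≡ true × Adj G x v ≡ true × edge u x ∈ M × V x ∈ M × edge x v ∈ M

  collapsed : (∃ λ m → m ∈ M × m ∈ elements) → TotalColoring G (suc (length rest))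
  collapsed (m , m∈M , m∈) = record
    { cv     = colour ∘ V
    ; ce     = λ u v → colour (edge u v)
    ; ce-sym = λ u v → cong colour (edge-sym u v)
    ; onto   = every-colour-used }
    where
    carried-by : ∀ {e c} → e ∈ elements → colour e ≡ c →
                 (∃ λ x → colour (V x) ≡ c) ⊎ (∃₂ λ u v → Adj G u v ≡ true × colour (edge u v) ≡ c)
    carried-by e∈ e-c with element-cases e∈
    ... | inj₁ (x , refl)             = inj₁ (x , e-c)
    ... | inj₂ (u , v , uv , refl)    = inj₂ (u , v , uv , e-c)
    every-colour-used : ∀ c → (∃ λ x → colour (V x) ≡ c) ⊎ (∃₂ λ u v → Adj G u v ≡ true × colour (edge u v) ≡ c)
    every-colour-used fzero    = carried-by m∈ (colour-M m∈M)
    every-colour-used (fsuc i) =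
      carried-by (proj₁ (∈-filter⁻ (¬? ∘ (_∈? M)) {xs = elements} (∈-lookup i))) (colour-rest i)

  collapsed-tmc : (m : ∃ λ m → m ∈ M × m ∈ elements) → MiddlesIn → IsTMC (collapsed m)
  collapsed-tmc _ middles u v u≢v with Adj G u v in uv
  ... | true  = colour (edge u v) , [] , ((u≢v ∷ []) ∷ [] ∷ []) , ((uv , refl) ∷ [-]) , []
  ... | false with middles u v u≢v uv
  ...   | x , ux , xv , ux∈M , x∈M , xv∈M =
    fzero , x ∷ [] , ((adjacent-≢ G ux ∷ u≢v ∷ []) ∷ (adjacent-≢ G xv ∷ []) ∷ [] ∷ []) ,
    ((ux , colour-M ux∈M) ∷ (xv , colour-M xv∈M) ∷ [-]) , (colour-M x∈M ∷ [])

  -- Only the elements of M lose their own colour.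
  collapsed-size : N ≤ length rest + length M
  collapsed-size = subst (_≤ length rest + length M)
                         (trans (ℕ.+-comm (length rest) _) (length-filter-split (_∈? M) elements))
                         (ℕ.+-monoʳ-≤ (length rest) inside≤M)
    where
    inside≤M : length (filter (_∈? M) elements) ≤ length M
    inside≤M = unique-⊆-length (Unique.filter⁺ (_∈? M) elements-unique)
                               (proj₂ ∘ ∈-filter⁻ (_∈? M) {xs = elements})

  collapse : (∃ λ m → m ∈ M × m ∈ elements) → MiddlesIn → ∃ λ k → HasTMC G k × suc N ≤ k + length M
  collapse m middles = suc (length rest) , (collapsed m , collapsed-tmc m middles) , s≤s collapsed-size

some-vertex : ∀ {n} (G : Graph n) → 0 < Elements.N G → Fin n
some-vertex {zero}  G ()
some-vertex {suc n} G _ = fzero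

module Tight {n t : ℕ} (G : Graph n) (col : TotalColoring G t) (tmc : IsTMC col)
             (maximal : ∀ k → HasTMC G k → k ≤ t) (t+3≡N : t + 3 ≡ Elements.N G) where
  open Elements G
  open TMCStructure col

  not-t+4≤N : ¬ (t + 4 ≤ N)
  not-t+4≤N t+4≤N = ℕ.<-irrefl refl (subst (_≤ N) (trans (ℕ.+-suc t 3) (cong suc t+3≡N)) t+4≤N)

  -- Collapsing at most three elements would give a TMC-colouring with more than t colours.
  no-small-collapse : (M : List (Element n)) → length M ≤ 3 → (∃ λ m → m ∈ M × m ∈ elements) →
                      ¬ Collapse.MiddlesIn G M
  no-small-collapse M |M|≤3 m middles =
    let k , k-colouring , N<k+|M| = Collapse.collapse G M m middles
    in ℕ.<-irrefl refl (ℕ.≤-trans N<k+|M| (subst (k + length M ≤_) t+3≡N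
                                             (ℕ.+-mono-≤ (maximal k k-colouring) |M|≤3)))

  centre : ∀ u v → u ≢ v → Adj G u v ≡ false → ∃ (Centre u v)
  centre u v u≢v uv with nonadjacent-centre tmc u v u≢v uv
  ... | inj₁ t+4≤N = ⊥-elim (not-t+4≤N t+4≤N)
  ... | inj₂ c     = c

  NonEdge : Fin n → Fin n → Set
  NonEdge u v = u ≢ v × Adj G u v ≡ false

  nonedge? : ∀ u v → Dec (NonEdge u v)
  nonedge? u v = ¬? (u ≟ v) ×-dec (Adj G u v Bool.≟ false)

  -- G is not complete: otherwise collapsing a single vertex is a TMC-colouring with N colours.
  not-complete : ¬ (∀ u v → ¬ NonEdge u v)
  not-complete complete =
    no-small-collapse (V x ∷ []) (s≤s z≤n) (V x , here refl , V∈elements x)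
                      λ u v u≢v uv → ⊥-elim (complete u v (u≢v , uv))
    where
    x : Fin n
    x = some-vertex G (subst (0 <_) (trans (ℕ.+-comm 3 t) t+3≡N) (s≤s z≤n))

  some-nonedge : ∃₂ NonEdge
  some-nonedge with any? (λ u → any? (λ v → nonedge? u v))
  ... | yes nonedge = nonedge
  ... | no  none    = ⊥-elim (not-complete λ u v uv → none (u , v , uv))

  -- {a,b} is not the only non-edge: otherwise collapsing its centre x with the edges ax
  -- and xb is a TMC-colouring with N − 2 colours.
  not-only-nonedge : ∀ {a b x} → Centre a b x → ¬ (∀ c d → NonEdge c d → SamePair c d a b)
  not-only-nonedge {a} {b} {x} ((ax , _) , (bx , _)) only =
    no-small-collapse M (s≤s (s≤s (s≤s z≤n))) (V x , here refl , V∈elements x) middles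
    where
    M : List (Element n)
    M = V x ∷ edge a x ∷ edge x b ∷ []
    middles : Collapse.MiddlesIn G M
    middles u v u≢v uv with only u v (u≢v , uv)
    ... | inj₁ (refl , refl) =
      x , ax , adj-sym G bx , there (here refl) , here refl , there (there (here refl))
    ... | inj₂ (refl , refl) =
      x , bx , adj-sym G ax , there (there (here (edge-sym b x))) , here refl , there (here (edge-sym x a))

  another-nonedge : ∀ {a b} → NonEdge a b → ∃₂ λ c d → NonEdge c d × ¬ SamePair c d a b
  another-nonedge {a} {b} (a≢b , ab)
    with any? (λ c → any? (λ d → nonedge? c d ×-dec ¬? (same-pair? c d a b)))
  ... | yes other = other
  ... | no  none  = ⊥-elim (not-only-nonedge (proj₂ (centre a b a≢b ab)) λ c d cd →
                             decidable-stable (same-pair? c d a b) λ cd≁ab → none (c , d , cd , cd≁ab))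

  nonedges-in-star : ∀ {x p q r} → Star3 x p q r → ∀ s t → NonEdge s t → PairOf s t p q r
  nonedges-in-star star3 s t (s≢t , st) with nonedge-in-star star3 s≢t (proj₂ (centre s t s≢t st))
  ... | inj₁ t+4≤N = ⊥-elim (not-t+4≤N t+4≤N)
  ... | inj₂ pair  = pair

  classify : NonEdgeStar → IsKnMinusK3 G ⊎ IsKnMinusP3 G
  classify (x , p , q , r , star3@(((p≢q ∷ p≢r ∷ []) ∷ (q≢r ∷ []) ∷ [] ∷ []) , _) , pq , qr)
    with Adj G p r in pr
  ... | false = inj₁ (p , q , r , p≢q , q≢r , p≢r , λ s t s≢t →
          mk⇔ (λ st → nonedges-in-star star3 s t (s≢t , st))
              λ { (inj₁ st~pq)        → same-pair-nonadjacent G pq st~pq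
                ; (inj₂ (inj₁ st~qr)) → same-pair-nonadjacent G qr st~qr
                ; (inj₂ (inj₂ st~pr)) → same-pair-nonadjacent G pr st~pr })
  ... | true = inj₂ (p , q , r , p≢q , q≢r , p≢r , λ s t s≢t →
          mk⇔ (λ st → not-pr st (nonedges-in-star star3 s t (s≢t , st)))
              λ { (inj₁ st~pq) → same-pair-nonadjacent G pq st~pq
                ; (inj₂ st~qr) → same-pair-nonadjacent G qr st~qr })
    where
    not-pr : ∀ {s t} → Adj G s t ≡ false → PairOf s t p q r → SamePair s t p q ⊎ SamePair s t q r
    not-pr _  (inj₁ st~pq)                        = inj₁ st~pq
    not-pr _  (inj₂ (inj₁ st~qr))                 = inj₂ st~qr
    not-pr st (inj₂ (inj₂ (inj₁ (refl , refl)))) with () ← trans (sym pr) st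
    not-pr st (inj₂ (inj₂ (inj₂ (refl , refl)))) with () ← trans (sym pr) (adj-sym G st)

  classification : IsKnMinusK3 G ⊎ IsKnMinusP3 G
  classification with some-nonedge
  ... | a , b , a≢b , ab with another-nonedge (a≢b , ab)
  ...   | c , d , (c≢d , cd) , cd≁ab with nonedges-star tmc a≢b c≢d cd≁ab ab cd
  ...     | inj₁ t+4≤N = ⊥-elim (not-t+4≤N t+4≤N)
  ...     | inj₂ star  = classify star

has-neighbour : ∀ {n} (G : Graph n) → Connected G → ∀ {b a} → b ≢ a → ∃ λ y → Adj G b y ≡ true
has-neighbour G connected {b} {a} b≢a with connected b a b≢a
... | []    , _ , (ba ∷ _) = a , ba
... | y ∷ _ , _ , (by ∷ _) = y , by

module Backward {n : ℕ} (G : Graph n) (connected : Connected G) {a b c : Fin n}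
                (a≢b : a ≢ b) (b≢c : b ≢ c) (a≢c : a ≢ c) (ab : Adj G a b ≡ false) (bc : Adj G b c ≡ false)
                (inside : ∀ u v → u ≢ v → Adj G u v ≡ false → u ∈ a ∷ b ∷ c ∷ [] × v ∈ a ∷ b ∷ c ∷ [])
                where
  open Elements G

  upper-bound : ∀ k → HasTMC G k → k + 3 ≤ N
  upper-bound k (col , tmc) = TMCStructure.two-nonedges-bound col tmc a≢b b≢c a≢c ab bc

  -- A neighbour y of b lies outside {a,b,c}, hence is adjacent to all of a, b, c.
  neighbour : ∃ λ y → Adj G b y ≡ true
  neighbour = has-neighbour G connected (≢-sym a≢b)

  y : Fin n
  y = proj₁ neighbour

  by : Adj G b y ≡ true
  by = proj₂ neighbour

  y-not-non-neighbour : ∀ {z} → Adj G b z ≡ false → y ≢ z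
  y-not-non-neighbour bz refl with () ← trans (sym by) bz

  y∉abc : y ∉ a ∷ b ∷ c ∷ []
  y∉abc (here y≡a)                 = y-not-non-neighbour (adj-sym G ab) y≡a
  y∉abc (there (here y≡b))         = adjacent-≢ G by (sym y≡b)
  y∉abc (there (there (here y≡c))) = y-not-non-neighbour bc y≡c

  y-adjacent : ∀ {s} → s ∈ a ∷ b ∷ c ∷ [] → Adj G s y ≡ true
  y-adjacent {s} s∈ with Adj G s y in sy
  ... | true  = refl
  ... | false = ⊥-elim (y∉abc (proj₂ (inside s y (λ s≡y → y∉abc (subst (_∈ _) s≡y s∈)) sy)))

  -- Collapsing y with its edges to a, b, c loses exactly three colours.
  M : List (Element n)
  M = V y ∷ edge a y ∷ edge b y ∷ edge c y ∷ []

  edge-to-y∈M : ∀ {s} → s ∈ a ∷ b ∷ c ∷ [] → edge s y ∈ M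
  edge-to-y∈M (here refl)                 = there (here refl)
  edge-to-y∈M (there (here refl))         = there (there (here refl))
  edge-to-y∈M (there (there (here refl))) = there (there (there (here refl)))

  middles : Collapse.MiddlesIn G M
  middles u v u≢v uv =
    let u∈ , v∈ = inside u v u≢v uv
    in y , y-adjacent u∈ , adj-sym G (y-adjacent v∈) ,
       edge-to-y∈M u∈ , here refl , subst (_∈ M) (edge-sym v y) (edge-to-y∈M v∈)

  tmc≡N-3 : Σ ℕ λ t → IsTmc G t × t + 3 ≡ edgeCount G + n
  tmc≡N-3 =
    let k , k-colouring , N<k+4 = Collapse.collapse G M (V y , here refl , V∈elements y) middles
        N≤k+3 = ℕ.≤-pred (subst (suc N ≤_) (ℕ.+-suc k 3) N<k+4)
        maximal : ∀ k′ → HasTMC G k′ → k′ ≤ k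
        maximal k′ k′-colouring = ℕ.+-cancelʳ-≤ 3 k′ k (ℕ.≤-trans (upper-bound k′ k′-colouring) N≤k+3)
    in k , (k-colouring , maximal) , trans (ℕ.≤-antisym (upper-bound k k-colouring) N≤k+3) N≡m+n

pair-inside : ∀ {n} {u v p q : Fin n} {L : List (Fin n)} → SamePair u v p q → p ∈ L → q ∈ L → u ∈ L × v ∈ L
pair-inside (inj₁ (refl , refl)) p∈ q∈ = p∈ , q∈
pair-inside (inj₂ (refl , refl)) p∈ q∈ = q∈ , p∈

backward : ∀ {n} (G : Graph n) → Connected G → IsKnMinusK3 G ⊎ IsKnMinusP3 G →
           Σ ℕ λ t → IsTmc G t × t + 3 ≡ edgeCount G + n
backward G connected (inj₁ (a , b , c , a≢b , b≢c , a≢c , nonedges)) =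
  Backward.tmc≡N-3 G connected a≢b b≢c a≢c
    (Equivalence.from (nonedges a b a≢b) (inj₁ (inj₁ (refl , refl))))
    (Equivalence.from (nonedges b c b≢c) (inj₂ (inj₁ (inj₁ (refl , refl)))))
    λ u v u≢v uv → [ (λ uv~ab → pair-inside uv~ab (here refl) (there (here refl)))
                   , [ (λ uv~bc → pair-inside uv~bc (there (here refl)) (there (there (here refl))))
                     , (λ uv~ac → pair-inside uv~ac (here refl) (there (there (here refl)))) ] ]
                   (Equivalence.to (nonedges u v u≢v) uv)
backward G connected (inj₂ (a , b , c , a≢b , b≢c , a≢c , nonedges)) =
  Backward.tmc≡N-3 G connected a≢b b≢c a≢c
    (Equivalence.from (nonedges a b a≢b) (inj₁ (inj₁ (refl , refl))))
    (Equivalence.from (nonedges b c b≢c) (inj₂ (inj₁ (refl , refl))))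
    λ u v u≢v uv → [ (λ uv~ab → pair-inside uv~ab (here refl) (there (here refl)))
                   , (λ uv~bc → pair-inside uv~bc (there (here refl)) (there (there (here refl)))) ]
                   (Equivalence.to (nonedges u v u≢v) uv)

theorem8 : (n : ℕ) (G : Graph n) → Connected G →
    ((Σ ℕ λ t → IsTmc G t × t + 3 ≡ edgeCount G + n) ⇔ (IsKnMinusK3 G ⊎ IsKnMinusP3 G))
theorem8 n G connected = mk⇔ forward (backward G connected)
  where
  forward : (Σ ℕ λ t → IsTmc G t × t + 3 ≡ edgeCount G + n) → IsKnMinusK3 G ⊎ IsKnMinusP3 G
  forward (t , ((col , tmc) , maximal) , t+3≡m+n) =
    Tight.classification G col tmc maximal (trans t+3≡m+n (sym (Elements.N≡m+n G)))
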